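{- Every finite graph $G$ admitting a nowhere-zero $4$-flow has a $3$-flow $\psi$ such that $|\mathrm{supp}\,\psi|\ge \frac{5}{6}|E(G)|$.
   Context: For an integer $k\ge 2$, a $k$-flow on an orientation $\vec{G}$ of a graph $G$ is a function $\psi\colon E(\vec{G})\to\mathbb{Z}$ such that at every vertex the sum of incoming flow values equals the sum of outgoing flow values, and $|\psi(z)|\le k-1$ for every arc $z$; a graph has a $k$-flow if some orientation of it has one. It is a nowhere-zero $k$-flow if moreover $\psi(z)\ne 0$ for every arc $z$. The support $\mathrm{supp}\,\psi$ of a flow $\psi$ is the set of arcs with non-zero flow value. -}

module Defs where

open import Data.Nat using (ℕ; zero; suc; _*_; _≤_)
open import Data.Integer as ℤ using (ℤ; ∣_∣; 0ℤ)
open import Data.Fin using (Fin; zero; suc)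
open import Data.Bool using (Bool; true; false; if_then_else_)
open import Data.Product using (_×_; _,_; proj₁; proj₂; Σ)
open import Relation.Nullary using (¬_; yes; no)
open import Relation.Binary.PropositionalEquality using (_≡_)
import Data.Fin as F
import Data.Integer.Properties as ℤP

-- A finite graph (loops and parallel edges allowed): vertex set Fin V,
-- edge set Fin E, each edge given by an (unordered) pair of endpoints.
record Graph : Set where
  field
    V   : ℕ
    E   : ℕ
    ends : Fin E → Fin V × Fin V
open Graph public

Orientation : Graph → Set
Orientation G = Fin (E G) → Bool

tail : (G : Graph) → Orientation G → Fin (E G) → Fin (V G)
tail G o e = if o e then proj₂ (ends G e) else proj₁ (ends G e)

head : (G : Graph) → Orientation G → Fin (E G) → Fin (V G)
head G o e = if o e then proj₁ (ends G e) else proj₂ (ends G e)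

Σℤ : (m : ℕ) → (Fin m → ℤ) → ℤ
Σℤ zero    f = 0ℤ
Σℤ (suc m) f = f zero ℤ.+ Σℤ m (λ i → f (suc i))

at : {n : ℕ} → Fin n → Fin n → ℤ → ℤ
at v w x with v F.≟ w
... | yes _ = x
... | no  _ = 0ℤ

IsConservative : (G : Graph) → Orientation G → (Fin (E G) → ℤ) → Set
IsConservative G o ψ =
  (v : Fin (V G)) →
  Σℤ (E G) (λ e → at (head G o e) v (ψ e)) ≡ Σℤ (E G) (λ e → at (tail G o e) v (ψ e))

-- k-flow on orientation o: conservation and |ψ(z)| ≤ k - 1 (written |ψ z| + 1 ≤ k)
IsKFlow : ℕ → (G : Graph) → Orientation G → (Fin (E G) → ℤ) → Set
IsKFlow k G o ψ = IsConservative G o ψ × ((e : Fin (E G)) → suc ∣ ψ e ∣ ≤ k)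

IsNowhereZeroKFlow : ℕ → (G : Graph) → Orientation G → (Fin (E G) → ℤ) → Set
IsNowhereZeroKFlow k G o ψ = IsKFlow k G o ψ × ((e : Fin (E G)) → ¬ (ψ e ≡ 0ℤ))

HasNZFlow : ℕ → Graph → Set
HasNZFlow k G = Σ (Orientation G) λ o → Σ (Fin (E G) → ℤ) λ ψ → IsNowhereZeroKFlow k G o ψ

suppSize : (m : ℕ) → (Fin m → ℤ) → ℕ
suppSize zero    ψ = zero
suppSize (suc m) ψ with ψ zero ℤP.≟ 0ℤ
... | yes _ = suppSize m (λ i → ψ (suc i))
... | no  _ = suc (suppSize m (λ i → ψ (suc i)))

-- Split the nowhere-zero 4-flow φ twice into parity parts, φ = h₁ + 2g₁ and g₁ = h₂ + 2g₂, and
-- then h₁ + h₂ = h₃ + 2g₃, where every hᵢ is a circulation with values in {0, ±1} congruent to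
-- the split value mod 2. Such a split exists because the arcs on which a circulation is odd
-- form an even-degree family, and by Euler's theorem such a family carries a ±1-valued
-- circulation; the even part then halves to a circulation. As 0 < |φ| < 4, h₁ and h₂ never
-- vanish together, and h₃ ≡ h₁ + h₂ (mod 2), so every edge lies in exactly two of the supports
-- of h₁, h₂, h₃. Hence every edge lies in exactly five of the supports of the six 3-flows
-- hᵢ ± hⱼ, and one of them has at least 5|E|/6 edges.
module Submission where

open import Defs
open import Data.Empty using (⊥-elim)
open import Data.Fin as Fin using (Fin; zero; suc)
open import Data.Fin.Patterns using (0F; 1F; 2F; 3F; 4F; 5F)
open import Data.Fin.Properties using (¬∀⟶∃¬)
open import Data.Nat as ℕ using (ℕ; zero; suc)
open import Data.Product using (Σ; ∃-syntax; _×_; _,_; proj₁; proj₂)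
open import Data.Vec.Functional as Vec using (Vector; _∷_; removeAt; insertAt)
open import Data.Vec.Functional.Properties using (insertAt-lookup; insertAt-punchIn)
open import Function using (_∘_; _⇔_; mk⇔; module Equivalence)
open import Relation.Nullary using (¬_; yes; no)
open import Relation.Binary.PropositionalEquality
import Data.Integer.Properties as ℤ
import Data.Nat.Divisibility as ℕ
import Data.Nat.Properties as ℕ

module _ where
  open import Data.Integer using (ℤ; +_; -[1+_]; 0ℤ; 1ℤ; -1ℤ; ∣_∣; _+_; _-_; -_; _*_; NonZero)
  open import Data.Integer.DivMod using (_%ℕ_; _/ℕ_; n%ℕd<d; a≡a%ℕn+[a/ℕn]*n)
  open import Data.Integer.Divisibility.Signed
    using (_∣_; divides; ∣-refl; ∣m∣n⇒∣m+n; ∣m∣n⇒∣m-n; ∣m+n∣n⇒∣m; ∣m⇒∣m*n; ∣n⇒∣m*n; ∣⇒∣ᵤ)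
  open import Data.Integer.Tactic.RingSolver using (solve-∀)
  open import Algebra.Properties.CommutativeMonoid.Sum ℤ.+-0-commutativeMonoid
    using (sum; sum-cong-≗; sum-remove; sum-replicate-zero; ∑-distrib-+)
  open import Algebra.Properties.Semiring.Sum ℤ.+-*-semiring using (*-distribʳ-sum)
  open ≡-Reasoning

  ∑-distrib-neg : ∀ {m} (f : Vector ℤ m) → sum (λ e → - f e) ≡ - sum f
  ∑-distrib-neg {zero}  f = refl
  ∑-distrib-neg {suc m} f = begin
    - f zero + sum (λ e → - f (suc e)) ≡⟨ cong (_+_ (- f zero)) (∑-distrib-neg (Vec.tail f)) ⟩
    - f zero + - sum (Vec.tail f)      ≡⟨ ℤ.neg-distrib-+ (f zero) _ ⟨
    - sum f                            ∎

  ∑-distrib-- : ∀ {m} (f g : Vector ℤ m) → sum (λ e → f e - g e) ≡ sum f - sum g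
  ∑-distrib-- {m} f g =
    trans (∑-distrib-+ {m} f (λ e → - g e)) (cong (_+_ (sum f)) (∑-distrib-neg g))

  Σℤ≡sum : ∀ m (f : Vector ℤ m) → Σℤ m f ≡ sum f
  Σℤ≡sum zero    f = refl
  Σℤ≡sum (suc m) f = cong (_+_ (f zero)) (Σℤ≡sum m (f ∘ suc))

  sum≢0⇒∃≢0 : ∀ {m} (f : Vector ℤ m) → sum f ≢ 0ℤ → ∃[ i ] f i ≢ 0ℤ
  sum≢0⇒∃≢0 {m} f sum≢0 = ¬∀⟶∃¬ m (λ i → f i ≡ 0ℤ) (λ i → f i ℤ.≟ 0ℤ)
    (λ f≗0 → sum≢0 (trans (sum-cong-≗ {m} f≗0) (sum-replicate-zero m)))

  insertAt-all : ∀ {A : Set} (P : A → Set) {m} (xs : Vector A m) j {c} →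
                 (∀ i → P (xs i)) → P c → ∀ i → P (insertAt xs j c i)
  insertAt-all P         xs zero    all-xs pc zero    = pc
  insertAt-all P         xs zero    all-xs pc (suc i) = all-xs i
  insertAt-all P {suc m} xs (suc j) all-xs pc zero    = all-xs zero
  insertAt-all P {suc m} xs (suc j) all-xs pc (suc i) =
    insertAt-all P (Vec.tail xs) j (all-xs ∘ suc) pc i

  data Unit : ℤ → Set where
    +1ᵘ : Unit 1ℤ
    -1ᵘ : Unit -1ℤ

  unit-* : ∀ {a b} → Unit a → Unit b → Unit (a * b)
  unit-* +1ᵘ +1ᵘ = +1ᵘ
  unit-* +1ᵘ -1ᵘ = -1ᵘ
  unit-* -1ᵘ +1ᵘ = -1ᵘ
  unit-* -1ᵘ -1ᵘ = +1ᵘ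

  ∣unit*i∣≡∣i∣ : ∀ {s} → Unit s → ∀ i → ∣ s * i ∣ ≡ ∣ i ∣
  ∣unit*i∣≡∣i∣ +1ᵘ i = cong ∣_∣ (ℤ.*-identityˡ i)
  ∣unit*i∣≡∣i∣ -1ᵘ i = trans (cong ∣_∣ (ℤ.-1*i≡-i i)) (ℤ.∣-i∣≡∣i∣ i)

  2∤1 : ¬ + 2 ∣ 1ℤ
  2∤1 (divides (+ 0)     ())
  2∤1 (divides (+ suc _) ())
  2∤1 (divides -[1+ _ ]  ())

  2∣unit-1 : ∀ {t} → Unit t → + 2 ∣ t - 1ℤ
  2∣unit-1 +1ᵘ = divides 0ℤ refl
  2∣unit-1 -1ᵘ = divides -1ℤ refl

  2∣i-unit*i : ∀ {s} → Unit s → ∀ i → + 2 ∣ i - s * i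
  2∣i-unit*i +1ᵘ i = divides 0ℤ (vanish i)
    where
    vanish : ∀ i → i - 1ℤ * i ≡ 0ℤ * + 2
    vanish = solve-∀
  2∣i-unit*i -1ᵘ i = divides i (double i)
    where
    double : ∀ i → i - -1ℤ * i ≡ i * + 2
    double = solve-∀

  2∣i-unit*[i%2] : ∀ {s} → Unit s → ∀ i → + 2 ∣ i - s * + (i %ℕ 2)
  2∣i-unit*[i%2] {s} s-unit i = subst (+ 2 ∣_) (sym i-s*r≡)
    (∣m∣n⇒∣m+n (2∣i-unit*i s-unit r) (∣n⇒∣m*n (i /ℕ 2) ∣-refl))
    where
    r : ℤ
    r = + (i %ℕ 2)
    regroup : ∀ r q s → (r + q * + 2) - s * r ≡ (r - s * r) + q * + 2
    regroup = solve-∀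
    i-s*r≡ : i - s * r ≡ (r - s * r) + (i /ℕ 2) * + 2
    i-s*r≡ = trans (cong (_- s * r) (a≡a%ℕn+[a/ℕn]*n i 2)) (regroup r (i /ℕ 2) s)

  ∣⇒∣∣≤∣∣ : ∀ {k z} → k ∣ z → z ≢ 0ℤ → ∣ k ∣ ℕ.≤ ∣ z ∣
  ∣⇒∣∣≤∣∣ k∣z z≢0 = ℕ.∣⇒≤ {{ℕ.≢-nonZero (z≢0 ∘ ℤ.∣i∣≡0⇒i≡0)}} (∣⇒∣ᵤ k∣z)

  low-digits≢0 : ∀ {φ g₁} h₁ h₂ g₂ → φ ≡ h₁ + g₁ * + 2 → g₁ ≡ h₂ + g₂ * + 2 →
                 φ ≢ 0ℤ → ∣ φ ∣ ℕ.< 4 → ¬ (h₁ ≡ 0ℤ × h₂ ≡ 0ℤ)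
  low-digits≢0 {φ} _ _ g₂ φ≡ g₁≡ φ≢0 φ<4 (refl , refl) =
    ℕ.<⇒≱ φ<4 (∣⇒∣∣≤∣∣ (divides g₂ φ≡g₂*4) φ≢0)
    where
    quadruple : ∀ g → 0ℤ + (0ℤ + g * + 2) * + 2 ≡ g * + 4
    quadruple = solve-∀
    φ≡g₂*4 : φ ≡ g₂ * + 4
    φ≡g₂*4 = trans φ≡ (trans (cong (λ g → 0ℤ + g * + 2) g₁≡) (quadruple g₂))

  -- Circulations on a family of arcs
  module _ {n : ℕ} where

    Arc : Set
    Arc = Fin n × Fin n

    δ : Arc → Fin n → ℤ
    δ (u , w) x = at w x 1ℤ - at u x 1ℤ

    ∂ : ∀ {m} → Vector Arc m → Vector ℤ m → Fin n → ℤ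
    ∂ α w x = sum (λ e → w e * δ (α e) x)

    IsCirculation : ∀ {m} → Vector Arc m → Vector ℤ m → Set
    IsCirculation α w = ∀ x → ∂ α w x ≡ 0ℤ

    module _ {m} (α : Vector Arc m) where

      ∂-cong : ∀ {v w} → (∀ e → v e ≡ w e) → ∀ x → ∂ α v x ≡ ∂ α w x
      ∂-cong v≗w x = sum-cong-≗ {m} (λ e → cong (_* δ (α e) x) (v≗w e))

      ∂-+ : ∀ v w x → ∂ α (λ e → v e + w e) x ≡ ∂ α v x + ∂ α w x
      ∂-+ v w x = trans (sum-cong-≗ {m} (λ e → ℤ.*-distribʳ-+ (δ (α e) x) (v e) (w e)))
                        (∑-distrib-+ {m} _ _)

      ∂-neg : ∀ w x → ∂ α (λ e → - w e) x ≡ - ∂ α w x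
      ∂-neg w x = trans (sum-cong-≗ {m} (λ e → sym (ℤ.neg-distribˡ-* (w e) (δ (α e) x))))
                        (∑-distrib-neg {m} _)

      ∂-*ʳ : ∀ w k x → ∂ α (λ e → w e * k) x ≡ ∂ α w x * k
      ∂-*ʳ w k x = trans (sum-cong-≗ {m} (λ e → swap (w e) k (δ (α e) x)))
                         (sym (*-distribʳ-sum {m} k _))
        where
        swap : ∀ a b c → a * b * c ≡ a * c * b
        swap = solve-∀

      circulation-+ : ∀ {v w} → IsCirculation α v → IsCirculation α w →
                      IsCirculation α (λ e → v e + w e)
      circulation-+ {v} {w} ∂v≡0 ∂w≡0 x = trans (∂-+ v w x) (cong₂ _+_ (∂v≡0 x) (∂w≡0 x))

      circulation-- : ∀ {v w} → IsCirculation α v → IsCirculation α w →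
                      IsCirculation α (λ e → v e - w e)
      circulation-- {v} {w} ∂v≡0 ∂w≡0 x = begin
        ∂ α (λ e → v e - w e) x        ≡⟨ ∂-+ v (λ e → - w e) x ⟩
        ∂ α v x + ∂ α (λ e → - w e) x  ≡⟨ cong (_+_ (∂ α v x)) (∂-neg w x) ⟩
        ∂ α v x - ∂ α w x              ≡⟨ cong₂ _-_ (∂v≡0 x) (∂w≡0 x) ⟩
        0ℤ                             ∎

      circulation-cancel-*ʳ : ∀ {w} k .{{_ : NonZero k}} →
                              IsCirculation α (λ e → w e * k) → IsCirculation α w
      circulation-cancel-*ʳ {w} k ∂wk≡0 x =
        ℤ.*-cancelʳ-≡ _ _ k (trans (sym (∂-*ʳ w k x)) (∂wk≡0 x))

      halve : ∀ {ψ h} → IsCirculation α ψ → IsCirculation α h → (∀ e → + 2 ∣ ψ e - h e) →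
              ∃[ g ] IsCirculation α g × (∀ e → ψ e ≡ h e + g e * + 2)
      halve {ψ} {h} ψ-circulation h-circulation 2∣ψ-h = g , g-circulation , ψ≡h+g*2
        where
        g : Vector ℤ m
        g e = _∣_.quotient (2∣ψ-h e)
        restore : ∀ a b → a ≡ b + (a - b)
        restore = solve-∀
        ψ≡h+g*2 : ∀ e → ψ e ≡ h e + g e * + 2
        ψ≡h+g*2 e = trans (restore (ψ e) (h e)) (cong (_+_ (h e)) (_∣_.equality (2∣ψ-h e)))
        g-circulation : IsCirculation α g
        g-circulation = circulation-cancel-*ʳ {g} (+ 2) λ x → trans
          (∂-cong (λ e → sym (_∣_.equality (2∣ψ-h e))) x)
          (circulation-- {ψ} {h} ψ-circulation h-circulation x)

    at-self : ∀ (v : Fin n) y → at v v y ≡ y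
    at-self v y with v Fin.≟ v
    ... | yes _   = refl
    ... | no v≢v = ⊥-elim (v≢v refl)

    at-≢ : ∀ {u v : Fin n} y → u ≢ v → at u v y ≡ 0ℤ
    at-≢ {u} {v} y u≢v with u Fin.≟ v
    ... | yes u≡v = ⊥-elim (u≢v u≡v)
    ... | no _    = refl

    at≡*at1 : ∀ (w x : Fin n) y → at w x y ≡ y * at w x 1ℤ
    at≡*at1 w x y with w Fin.≟ x
    ... | yes _ = sym (ℤ.*-identityʳ y)
    ... | no _  = sym (ℤ.*-zeroʳ y)

    δ-loop : ∀ u x → δ (u , u) x ≡ 0ℤ
    δ-loop u x = ℤ.+-inverseʳ (at u x 1ℤ)

    δ-head : ∀ {u v} → u ≢ v → δ (u , v) v ≡ 1ℤ
    δ-head {u} {v} u≢v = cong₂ _-_ (at-self v 1ℤ) (at-≢ 1ℤ u≢v)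

    δ-trans : ∀ u v w x → δ (u , v) x + δ (v , w) x ≡ δ (u , w) x
    δ-trans u v w x = telescope (at u x 1ℤ) (at v x 1ℤ) (at w x 1ℤ)
      where
      telescope : ∀ a b c → (b - a) + (c - b) ≡ c - a
      telescope = solve-∀

    data Incident (v : Fin n) : Arc → Set where
      outgoing : ∀ w → Incident v (v , w)
      incoming : ∀ w → Incident v (w , v)

    incident : ∀ {v} a → δ a v ≢ 0ℤ → Incident v a
    incident {v} (a , b) δ≢0 with a Fin.≟ v | b Fin.≟ v
    ... | yes refl | _        = outgoing b
    ... | no _     | yes refl = incoming a
    ... | no _     | no _     = ⊥-elim (δ≢0 refl)

    far : ∀ {v a} → Incident v a → Fin n
    far (outgoing w) = w
    far (incoming w) = w

    direction : ∀ {v a} → Incident v a → ℤ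
    direction (outgoing _) = 1ℤ
    direction (incoming _) = -1ℤ

    direction-unit : ∀ {v a} (i : Incident v a) → Unit (direction i)
    direction-unit (outgoing _) = +1ᵘ
    direction-unit (incoming _) = -1ᵘ

    δ-incident : ∀ {v a} (i : Incident v a) x → δ a x ≡ direction i * δ (v , far i) x
    δ-incident {v} (outgoing w) x = sym (ℤ.*-identityˡ (δ (v , w) x))
    δ-incident {v} (incoming w) x = reverse (at v x 1ℤ) (at w x 1ℤ)
      where
      reverse : ∀ a b → a - b ≡ -1ℤ * (b - a)
      reverse = solve-∀

    ∂-removeAt : ∀ {m} (α : Vector Arc (suc m)) w j x →
                 ∂ α w x ≡ w j * δ (α j) x + ∂ (removeAt α j) (removeAt w j) x
    ∂-removeAt α w j x = sum-remove (λ e → w e * δ (α e) x)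

    ∂-insertAt : ∀ {m} (α : Vector Arc (suc m)) w j c x →
                 ∂ α (insertAt w j c) x ≡ c * δ (α j) x + ∂ (removeAt α j) w x
    ∂-insertAt α w j c x = begin
      ∂ α (insertAt w j c) x
        ≡⟨ ∂-removeAt α (insertAt w j c) j x ⟩
      insertAt w j c j * δ (α j) x + ∂ (removeAt α j) (removeAt (insertAt w j c) j) x
        ≡⟨ cong₂ (λ a b → a * δ (α j) x + b) (insertAt-lookup w j c)
                 (∂-cong (removeAt α j) (insertAt-punchIn w j c) x) ⟩
      c * δ (α j) x + ∂ (removeAt α j) w x
        ∎

    IsLoop : Arc → Set
    IsLoop (u , v) = u ≡ v

    ∂-loop : ∀ {m} (α : Vector Arc (suc m)) → IsLoop (α zero) →
             ∀ w x → ∂ α w x ≡ ∂ (Vec.tail α) (Vec.tail w) x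
    ∂-loop α loop w x = begin
      w zero * δ (α zero) x + ∂ (Vec.tail α) (Vec.tail w) x
        ≡⟨ cong (λ d → w zero * d + ∂ (Vec.tail α) (Vec.tail w) x) δ≡0 ⟩
      w zero * 0ℤ + ∂ (Vec.tail α) (Vec.tail w) x
        ≡⟨ cong (_+ ∂ (Vec.tail α) (Vec.tail w) x) (ℤ.*-zeroʳ (w zero)) ⟩
      0ℤ + ∂ (Vec.tail α) (Vec.tail w) x
        ≡⟨ ℤ.+-identityˡ _ ⟩
      ∂ (Vec.tail α) (Vec.tail w) x
        ∎
      where
      δ≡0 : δ (α zero) x ≡ 0ℤ
      δ≡0 rewrite loop = δ-loop (proj₂ (α zero)) x

    -- Euler's theorem: an even-degree family carries a ±1-valued circulation

    -- In-degree minus out-degree has the parity of the degree (a loop counts 0, not 2).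
    HasEvenDegrees : ∀ {m} → Vector Arc m → Set
    HasEvenDegrees α = ∀ x → + 2 ∣ ∂ α (λ _ → 1ℤ) x

    record SignedCirculation {m} (α : Vector Arc m) : Set where
      field
        sign        : Vector ℤ m
        sign-unit   : ∀ e → Unit (sign e)
        circulation : IsCirculation α sign

    tail-∂≢0 : ∀ {m} (α : Vector Arc (suc m)) → ¬ IsLoop (α zero) → HasEvenDegrees α →
               ∂ (Vec.tail α) (λ _ → 1ℤ) (proj₂ (α zero)) ≢ 0ℤ
    tail-∂≢0 α ¬loop even rest≡0 = 2∤1 (subst (+ 2 ∣_) ∂α≡1 (even (proj₂ (α zero))))
      where
      ∂α≡1 : ∂ α (λ _ → 1ℤ) (proj₂ (α zero)) ≡ 1ℤ
      ∂α≡1 = cong₂ (λ d r → 1ℤ * d + r) (δ-head ¬loop) rest≡0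

    incidentArc : ∀ {m} (α : Vector Arc (suc (suc m))) → ¬ IsLoop (α zero) → HasEvenDegrees α →
                  ∃[ j ] Incident (proj₂ (α zero)) (α (suc j))
    incidentArc α ¬loop even with sum≢0⇒∃≢0 (λ e → 1ℤ * δ (α (suc e)) (proj₂ (α zero)))
                                             (tail-∂≢0 α ¬loop even)
    ... | j , 1δ≢0 = j , incident (α (suc j)) (1δ≢0 ∘ trans (ℤ.*-identityˡ _))

    -- Splitting off at v: the arc u → v and an arc at v, read as v → w, are merged into
    -- u → w. A signing of the merged family lifts back by giving u → v the sign of u → w,
    -- and the arc at v that sign times its direction.
    module SplitOff {m} (α : Vector Arc (suc (suc m))) (j : Fin (suc m))
                    (inc : Incident (proj₂ (α zero)) (α (suc j))) where

      private
        u v w : Fin n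
        u = proj₁ (α zero)
        v = proj₂ (α zero)
        w = far inc
        β : Vector Arc (suc m)
        β = Vec.tail α
        t : ℤ
        t = direction inc

      merged : Vector Arc (suc m)
      merged = (u , w) ∷ removeAt β j

      merged-even : HasEvenDegrees α → HasEvenDegrees merged
      merged-even even x = subst (+ 2 ∣_) (sym ∂merged≡)
        (∣m∣n⇒∣m-n (even x) (∣m⇒∣m*n (δ (v , w) x) (2∣unit-1 (direction-unit inc))))
        where
        ones : ∀ {k} → Vector ℤ k
        ones _ = 1ℤ
        A D R : ℤ
        A = δ (u , v) x
        D = δ (v , w) x
        R = ∂ (removeAt β j) ones x
        shuffle : ∀ t A D R → 1ℤ * (A + D) + R ≡ (1ℤ * A + (1ℤ * (t * D) + R)) - (t - 1ℤ) * D
        shuffle = solve-∀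
        ∂merged≡ : ∂ merged ones x ≡ ∂ α ones x - (t - 1ℤ) * D
        ∂merged≡ = begin
          1ℤ * δ (u , w) x + R
            ≡⟨ cong (λ d → 1ℤ * d + R) (δ-trans u v w x) ⟨
          1ℤ * (A + D) + R
            ≡⟨ shuffle t A D R ⟩
          (1ℤ * A + (1ℤ * (t * D) + R)) - (t - 1ℤ) * D
            ≡⟨ cong (λ d → (1ℤ * A + (1ℤ * d + R)) - (t - 1ℤ) * D) (δ-incident inc x) ⟨
          (1ℤ * A + (1ℤ * δ (β j) x + R)) - (t - 1ℤ) * D
            ≡⟨ cong (λ r → (1ℤ * A + r) - (t - 1ℤ) * D) (∂-removeAt β ones j x) ⟨
          ∂ α ones x - (t - 1ℤ) * D
            ∎

      lifted : Vector ℤ (suc m) → Vector ℤ (suc (suc m))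
      lifted s = s zero ∷ insertAt (Vec.tail s) j (s zero * t)

      ∂-lifted : ∀ s x → ∂ α (lifted s) x ≡ ∂ merged s x
      ∂-lifted s x = begin
        s₀ * A + ∂ β (insertAt (Vec.tail s) j (s₀ * t)) x
          ≡⟨ cong (_+_ (s₀ * A)) (∂-insertAt β (Vec.tail s) j (s₀ * t) x) ⟩
        s₀ * A + ((s₀ * t) * δ (β j) x + R)
          ≡⟨ cong (λ d → s₀ * A + ((s₀ * t) * d + R)) (δ-incident inc x) ⟩
        s₀ * A + ((s₀ * t) * (t * D) + R)
          ≡⟨ cancel (direction-unit inc) s₀ A D R ⟩
        s₀ * (A + D) + R
          ≡⟨ cong (λ d → s₀ * d + R) (δ-trans u v w x) ⟩
        s₀ * δ (u , w) x + R
          ∎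
        where
        s₀ A D R : ℤ
        s₀ = s zero
        A = δ (u , v) x
        D = δ (v , w) x
        R = ∂ (removeAt β j) (Vec.tail s) x
        cancel : ∀ {t} → Unit t → ∀ s A D R → s * A + ((s * t) * (t * D) + R) ≡ s * (A + D) + R
        cancel +1ᵘ = solve-∀
        cancel -1ᵘ = solve-∀

      lift : SignedCirculation merged → SignedCirculation α
      lift S = record
        { sign        = lifted sign
        ; sign-unit   = λ
            { zero    → sign-unit zero
            ; (suc e) → insertAt-all Unit (Vec.tail sign) j (sign-unit ∘ suc)
                          (unit-* (sign-unit zero) (direction-unit inc)) e
            }
        ; circulation = λ x → trans (∂-lifted sign x) (circulation x)
        }
        where open SignedCirculation S

    signedCirculation : ∀ {m} (α : Vector Arc m) → HasEvenDegrees α → SignedCirculation α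
    splitOff : ∀ {m} (α : Vector Arc (suc m)) → ¬ IsLoop (α zero) → HasEvenDegrees α →
               SignedCirculation α

    signedCirculation {zero} α even =
      record { sign = λ () ; sign-unit = λ () ; circulation = λ _ → refl }
    signedCirculation {suc m} α even with proj₁ (α zero) Fin.≟ proj₂ (α zero)
    ... | no ¬loop = splitOff α ¬loop even
    ... | yes loop = record
      { sign        = 1ℤ ∷ sign
      ; sign-unit   = λ { zero → +1ᵘ ; (suc e) → sign-unit e }
      ; circulation = λ x → trans (∂-loop α loop (1ℤ ∷ sign) x) (circulation x)
      }
      where
      tail-even : HasEvenDegrees (Vec.tail α)
      tail-even x = subst (+ 2 ∣_) (∂-loop α loop (λ _ → 1ℤ) x) (even x)
      open SignedCirculation (signedCirculation (Vec.tail α) tail-even)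

    splitOff {zero}  α ¬loop even = ⊥-elim (tail-∂≢0 α ¬loop even refl)
    splitOff {suc m} α ¬loop even = lift (signedCirculation merged (merged-even even))
      where open SplitOff α (proj₁ (incidentArc α ¬loop even)) (proj₂ (incidentArc α ¬loop even))

    -- Splitting a circulation by parity

    -- Arcs carrying an even value are contracted to loops, which contribute nothing to ∂.
    collapse : ℕ → Arc → Arc
    collapse zero    (u , _) = u , u
    collapse (suc _) a       = a

    δ-collapse : ∀ {r} a x → r ℕ.< 2 → δ (collapse r a) x ≡ + r * δ a x
    δ-collapse {0}           (u , _) x _ = δ-loop u x
    δ-collapse {1}           a       x _ = sym (ℤ.*-identityˡ (δ a x))
    δ-collapse {suc (suc _)} a       x (ℕ.s≤s (ℕ.s≤s ()))

    oddArcs : ∀ {m} → Vector Arc m → Vector ℤ m → Vector Arc m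
    oddArcs α ψ e = collapse (ψ e %ℕ 2) (α e)

    ∂-oddArcs : ∀ {m} (α : Vector Arc m) ψ w x →
                ∂ (oddArcs α ψ) w x ≡ ∂ α (λ e → w e * + (ψ e %ℕ 2)) x
    ∂-oddArcs {m} α ψ w x = sum-cong-≗ {m} λ e → begin
      w e * δ (oddArcs α ψ e) x         ≡⟨ cong (w e *_) (δ-collapse (α e) x (n%ℕd<d (ψ e) 2)) ⟩
      w e * (+ (ψ e %ℕ 2) * δ (α e) x)  ≡⟨ ℤ.*-assoc (w e) (+ (ψ e %ℕ 2)) _ ⟨
      w e * + (ψ e %ℕ 2) * δ (α e) x    ∎

    oddArcs-even : ∀ {m} (α : Vector Arc m) {ψ} → IsCirculation α ψ → HasEvenDegrees (oddArcs α ψ)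
    oddArcs-even {m} α {ψ} ψ-circulation x =
      ∣m+n∣n⇒∣m (subst (+ 2 ∣_) 0≡∂odd+∂q*2 (divides 0ℤ refl)) (∣n⇒∣m*n (∂ α q x) ∣-refl)
      where
      r q : Vector ℤ m
      r e = + (ψ e %ℕ 2)
      q e = ψ e /ℕ 2
      0≡∂odd+∂q*2 : 0ℤ ≡ ∂ (oddArcs α ψ) (λ _ → 1ℤ) x + ∂ α q x * + 2
      0≡∂odd+∂q*2 = begin
        0ℤ
          ≡⟨ ψ-circulation x ⟨
        ∂ α ψ x
          ≡⟨ ∂-cong α (λ e → a≡a%ℕn+[a/ℕn]*n (ψ e) 2) x ⟩
        ∂ α (λ e → r e + q e * + 2) x
          ≡⟨ ∂-+ α r (λ e → q e * + 2) x ⟩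
        ∂ α r x + ∂ α (λ e → q e * + 2) x
          ≡⟨ cong₂ _+_ (∂-cong α (λ e → sym (ℤ.*-identityˡ (r e))) x) (∂-*ʳ α q (+ 2) x) ⟩
        ∂ α (λ e → 1ℤ * r e) x + ∂ α q x * + 2
          ≡⟨ cong (_+ ∂ α q x * + 2) (∂-oddArcs α ψ (λ _ → 1ℤ) x) ⟨
        ∂ (oddArcs α ψ) (λ _ → 1ℤ) x + ∂ α q x * + 2
          ∎

    record ParitySplit {m} (α : Vector Arc m) (ψ : Vector ℤ m) : Set where
      field
        quotient remainder    : Vector ℤ m
        quotient-circulation  : IsCirculation α quotient
        remainder-circulation : IsCirculation α remainder
        split                 : ∀ e → ψ e ≡ remainder e + quotient e * + 2
        ∣remainder∣           : ∀ e → ∣ remainder e ∣ ≡ ψ e %ℕ 2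

      remainder-small : ∀ e → ∣ remainder e ∣ ℕ.≤ 1
      remainder-small e = subst (ℕ._≤ 1) (sym (∣remainder∣ e)) (ℕ.≤-pred (n%ℕd<d (ψ e) 2))

    paritySplit : ∀ {m} (α : Vector Arc m) ψ → IsCirculation α ψ → ParitySplit α ψ
    paritySplit {m} α ψ ψ-circulation = record
      { quotient              = proj₁ half
      ; remainder             = h
      ; quotient-circulation  = proj₁ (proj₂ half)
      ; remainder-circulation = h-circulation
      ; split                 = proj₂ (proj₂ half)
      ; ∣remainder∣           = λ e → ∣unit*i∣≡∣i∣ (sign-unit e) (+ (ψ e %ℕ 2))
      }
      where
      open SignedCirculation (signedCirculation (oddArcs α ψ) (oddArcs-even α {ψ} ψ-circulation))
      h : Vector ℤ m
      h e = sign e * + (ψ e %ℕ 2)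
      h-circulation : IsCirculation α h
      h-circulation x = trans (sym (∂-oddArcs α ψ sign x)) (circulation x)
      half : ∃[ g ] IsCirculation α g × (∀ e → ψ e ≡ h e + g e * + 2)
      half = halve α ψ-circulation h-circulation (λ e → 2∣i-unit*[i%2] (sign-unit e) (ψ e))

  -- Flows on an oriented graph
  module _ (G : Graph) (o : Orientation G) where

    arcs : Vector Arc (E G)
    arcs e = tail G o e , head G o e

    ∂-arcs : ∀ ψ v → ∂ arcs ψ v ≡ Σℤ (E G) (λ e → at (head G o e) v (ψ e))
                                  - Σℤ (E G) (λ e → at (tail G o e) v (ψ e))
    ∂-arcs ψ v = begin
      sum (λ e → ψ e * (at (head G o e) v 1ℤ - at (tail G o e) v 1ℤ))
        ≡⟨ sum-cong-≗ {E G} (λ e → distrib (ψ e) _ _) ⟩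
      sum (λ e → ψ e * at (head G o e) v 1ℤ - ψ e * at (tail G o e) v 1ℤ)
        ≡⟨ ∑-distrib-- {E G} _ _ ⟩
      sum (λ e → ψ e * at (head G o e) v 1ℤ) - sum (λ e → ψ e * at (tail G o e) v 1ℤ)
        ≡⟨ cong₂ _-_ (sum≡Σℤ head) (sum≡Σℤ tail) ⟩
      Σℤ (E G) (λ e → at (head G o e) v (ψ e)) - Σℤ (E G) (λ e → at (tail G o e) v (ψ e))
        ∎
      where
      distrib : ∀ a b c → a * (b - c) ≡ a * b - a * c
      distrib = solve-∀
      sum≡Σℤ : (end : (G : Graph) → Orientation G → Fin (E G) → Fin (V G)) →
               sum (λ e → ψ e * at (end G o e) v 1ℤ) ≡ Σℤ (E G) (λ e → at (end G o e) v (ψ e))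
      sum≡Σℤ end =
        sym (trans (Σℤ≡sum (E G) _) (sum-cong-≗ {E G} (λ e → at≡*at1 (end G o e) v (ψ e))))

    conservative⇔circulation : ∀ ψ → IsConservative G o ψ ⇔ IsCirculation arcs ψ
    conservative⇔circulation ψ = mk⇔
      (λ conservative v → trans (∂-arcs ψ v) (ℤ.i≡j⇒i-j≡0 (conservative v)))
      (λ circulation v → ℤ.i-j≡0⇒i≡j _ _ (trans (sym (∂-arcs ψ v)) (circulation v)))

  -- Six 3-flows from a nowhere-zero 4-flow
  data Trit : ℤ → Set where
    -1ᵗ : Trit -1ℤ
    0ᵗ  : Trit 0ℤ
    +1ᵗ : Trit 1ℤ

  trit : ∀ {a} → ∣ a ∣ ℕ.≤ 1 → Trit a
  trit {+ 0}           _ = 0ᵗ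
  trit {+ 1}           _ = +1ᵗ
  trit { -[1+ 0 ]}     _ = -1ᵗ
  trit {+ suc (suc _)} (ℕ.s≤s ())
  trit { -[1+ suc _ ]} (ℕ.s≤s ())

  sumOrDifference : Fin 6 → ℤ → ℤ → ℤ → ℤ
  sumOrDifference 0F a b c = a + b
  sumOrDifference 1F a b c = a - b
  sumOrDifference 2F a b c = a + c
  sumOrDifference 3F a b c = a - c
  sumOrDifference 4F a b c = b + c
  sumOrDifference 5F a b c = b - c

  fiveOfSixNonZero : ∀ {a b c} → Trit a → Trit b → Trit c → ∣ c ∣ ≡ (a + b) %ℕ 2 →
                     ¬ (a ≡ 0ℤ × b ≡ 0ℤ) → suppSize 6 (λ i → sumOrDifference i a b c) ≡ 5
  fiveOfSixNonZero 0ᵗ  0ᵗ  _   _  a≡0×b≡0 = ⊥-elim (a≡0×b≡0 (refl , refl))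
  fiveOfSixNonZero -1ᵗ -1ᵗ 0ᵗ  _  _ = refl
  fiveOfSixNonZero -1ᵗ -1ᵗ -1ᵗ () _
  fiveOfSixNonZero -1ᵗ -1ᵗ +1ᵗ () _
  fiveOfSixNonZero -1ᵗ 0ᵗ  0ᵗ  () _
  fiveOfSixNonZero -1ᵗ 0ᵗ  -1ᵗ _  _ = refl
  fiveOfSixNonZero -1ᵗ 0ᵗ  +1ᵗ _  _ = refl
  fiveOfSixNonZero -1ᵗ +1ᵗ 0ᵗ  _  _ = refl
  fiveOfSixNonZero -1ᵗ +1ᵗ -1ᵗ () _
  fiveOfSixNonZero -1ᵗ +1ᵗ +1ᵗ () _
  fiveOfSixNonZero 0ᵗ  -1ᵗ 0ᵗ  () _
  fiveOfSixNonZero 0ᵗ  -1ᵗ -1ᵗ _  _ = refl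
  fiveOfSixNonZero 0ᵗ  -1ᵗ +1ᵗ _  _ = refl
  fiveOfSixNonZero 0ᵗ  +1ᵗ 0ᵗ  () _
  fiveOfSixNonZero 0ᵗ  +1ᵗ -1ᵗ _  _ = refl
  fiveOfSixNonZero 0ᵗ  +1ᵗ +1ᵗ _  _ = refl
  fiveOfSixNonZero +1ᵗ -1ᵗ 0ᵗ  _  _ = refl
  fiveOfSixNonZero +1ᵗ -1ᵗ -1ᵗ () _
  fiveOfSixNonZero +1ᵗ -1ᵗ +1ᵗ () _
  fiveOfSixNonZero +1ᵗ 0ᵗ  0ᵗ  () _
  fiveOfSixNonZero +1ᵗ 0ᵗ  -1ᵗ _  _ = refl
  fiveOfSixNonZero +1ᵗ 0ᵗ  +1ᵗ _  _ = refl
  fiveOfSixNonZero +1ᵗ +1ᵗ 0ᵗ  _  _ = refl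
  fiveOfSixNonZero +1ᵗ +1ᵗ -1ᵗ () _
  fiveOfSixNonZero +1ᵗ +1ᵗ +1ᵗ () _

  ∣i+j∣<3 : ∀ i j → ∣ i ∣ ℕ.≤ 1 → ∣ j ∣ ℕ.≤ 1 → ∣ i + j ∣ ℕ.< 3
  ∣i+j∣<3 i j i≤1 j≤1 = ℕ.s≤s (ℕ.≤-trans (ℤ.∣i+j∣≤∣i∣+∣j∣ i j) (ℕ.+-mono-≤ i≤1 j≤1))

  ∣i-j∣<3 : ∀ i j → ∣ i ∣ ℕ.≤ 1 → ∣ j ∣ ℕ.≤ 1 → ∣ i - j ∣ ℕ.< 3
  ∣i-j∣<3 i j i≤1 j≤1 = ℕ.s≤s (ℕ.≤-trans (ℤ.∣i-j∣≤∣i∣+∣j∣ i j) (ℕ.+-mono-≤ i≤1 j≤1))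

  sumOrDifference-bound : ∀ i {a b c} → ∣ a ∣ ℕ.≤ 1 → ∣ b ∣ ℕ.≤ 1 → ∣ c ∣ ℕ.≤ 1 →
                          ∣ sumOrDifference i a b c ∣ ℕ.< 3
  sumOrDifference-bound 0F {a} {b} {c} a≤1 b≤1 c≤1 = ∣i+j∣<3 a b a≤1 b≤1
  sumOrDifference-bound 1F {a} {b} {c} a≤1 b≤1 c≤1 = ∣i-j∣<3 a b a≤1 b≤1
  sumOrDifference-bound 2F {a} {b} {c} a≤1 b≤1 c≤1 = ∣i+j∣<3 a c a≤1 c≤1
  sumOrDifference-bound 3F {a} {b} {c} a≤1 b≤1 c≤1 = ∣i-j∣<3 a c a≤1 c≤1
  sumOrDifference-bound 4F {a} {b} {c} a≤1 b≤1 c≤1 = ∣i+j∣<3 b c b≤1 c≤1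
  sumOrDifference-bound 5F {a} {b} {c} a≤1 b≤1 c≤1 = ∣i-j∣<3 b c b≤1 c≤1

  module _ {n m} (α : Vector (Arc {n}) m) where

    sumOrDifference-circulation : ∀ i {a b c} →
      IsCirculation α a → IsCirculation α b → IsCirculation α c →
      IsCirculation α (λ e → sumOrDifference i (a e) (b e) (c e))
    sumOrDifference-circulation 0F {a} {b} {c} ∂a ∂b ∂c = circulation-+ α {a} {b} ∂a ∂b
    sumOrDifference-circulation 1F {a} {b} {c} ∂a ∂b ∂c = circulation-- α {a} {b} ∂a ∂b
    sumOrDifference-circulation 2F {a} {b} {c} ∂a ∂b ∂c = circulation-+ α {a} {c} ∂a ∂c
    sumOrDifference-circulation 3F {a} {b} {c} ∂a ∂b ∂c = circulation-- α {a} {c} ∂a ∂c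
    sumOrDifference-circulation 4F {a} {b} {c} ∂a ∂b ∂c = circulation-+ α {b} {c} ∂b ∂c
    sumOrDifference-circulation 5F {a} {b} {c} ∂a ∂b ∂c = circulation-- α {b} {c} ∂b ∂c

    record SixThreeFlows : Set where
      field
        flow         : Fin 6 → Vector ℤ m
        circulation  : ∀ i → IsCirculation α (flow i)
        bound        : ∀ i e → ∣ flow i e ∣ ℕ.< 3
        five-nonzero : ∀ e → suppSize 6 (λ i → flow i e) ≡ 5

    sixThreeFlows : ∀ φ → IsCirculation α φ → (∀ e → φ e ≢ 0ℤ) → (∀ e → ∣ φ e ∣ ℕ.< 4) →
                    SixThreeFlows
    sixThreeFlows φ φ-circulation φ≢0 φ<4 = record
      { flow         = λ i e → sumOrDifference i (h₁ e) (h₂ e) (h₃ e)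
      ; circulation  = λ i → sumOrDifference-circulation i
                               h₁-circulation h₂-circulation h₃-circulation
      ; bound        = λ i e → sumOrDifference-bound i (h₁-small e) (h₂-small e) (h₃-small e)
      ; five-nonzero = λ e → fiveOfSixNonZero
                               (trit (h₁-small e)) (trit (h₂-small e)) (trit (h₃-small e))
                               (S₃.∣remainder∣ e) (h₁h₂≢0 e)
      }
      where
      module S₁ = ParitySplit (paritySplit α φ φ-circulation)
      module S₂ = ParitySplit (paritySplit α S₁.quotient S₁.quotient-circulation)
      module S₃ = ParitySplit (paritySplit α (λ e → S₁.remainder e + S₂.remainder e)
                    (circulation-+ α {S₁.remainder} {S₂.remainder}
                      S₁.remainder-circulation S₂.remainder-circulation))
      open S₁ using () renaming (remainder to h₁; remainder-circulation to h₁-circulation;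
                                 remainder-small to h₁-small)
      open S₂ using () renaming (remainder to h₂; remainder-circulation to h₂-circulation;
                                 remainder-small to h₂-small)
      open S₃ using () renaming (remainder to h₃; remainder-circulation to h₃-circulation;
                                 remainder-small to h₃-small)

      h₁h₂≢0 : ∀ e → ¬ (h₁ e ≡ 0ℤ × h₂ e ≡ 0ℤ)
      h₁h₂≢0 e =
        low-digits≢0 (h₁ e) (h₂ e) (S₂.quotient e) (S₁.split e) (S₂.split e) (φ≢0 e) (φ<4 e)

open import Data.Integer using (ℤ; 0ℤ)
open import Data.Nat using (_*_; _≤_)
open import Algebra.Properties.CommutativeMonoid.Sum ℕ.+-0-commutativeMonoid
  using (sum; sum-cong-≗; ∑-comm)
open Equivalence using (to; from)

χ≢0 : ℤ → ℕ
χ≢0 z with z ℤ.≟ 0ℤ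
... | yes _ = 0
... | no _  = 1

suppSize≡sum : ∀ m (ψ : Vector ℤ m) → suppSize m ψ ≡ sum (λ e → χ≢0 (ψ e))
suppSize≡sum zero    ψ = refl
suppSize≡sum (suc m) ψ with ψ zero ℤ.≟ 0ℤ
... | yes _ = suppSize≡sum m (ψ ∘ suc)
... | no _  = cong suc (suppSize≡sum m (ψ ∘ suc))

suppSize-comm : ∀ {k m} (F : Fin k → Vector ℤ m) →
                sum (λ i → suppSize m (F i)) ≡ sum (λ e → suppSize k (λ i → F i e))
suppSize-comm {k} {m} F = begin
  sum (λ i → suppSize m (F i))          ≡⟨ sum-cong-≗ {k} (λ i → suppSize≡sum m (F i)) ⟩
  sum (λ i → sum (λ e → χ≢0 (F i e)))   ≡⟨ ∑-comm (λ i e → χ≢0 (F i e)) ⟩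
  sum (λ e → sum (λ i → χ≢0 (F i e)))   ≡⟨ sum-cong-≗ {m} (λ e → suppSize≡sum k (λ i → F i e)) ⟨
  sum (λ e → suppSize k (λ i → F i e))  ∎
  where open ≡-Reasoning

sum-const : ∀ m c → sum {m} (λ _ → c) ≡ m * c
sum-const zero    c = refl
sum-const (suc m) c = cong (c ℕ.+_) (sum-const m c)

∃-≥-average : ∀ {k} (f : Vector ℕ (suc k)) → ∃[ i ] sum f ≤ suc k * f i
∃-≥-average {zero}  f = zero , ℕ.≤-refl
∃-≥-average {suc k} f with ∃-≥-average (Vec.tail f)
... | i , ∑tail≤ with f (suc i) ℕ.≤? f zero
...   | yes fᵢ≤f₀ = zero  , ℕ.+-monoʳ-≤ (f zero) (ℕ.≤-trans ∑tail≤ (ℕ.*-monoʳ-≤ (suc k) fᵢ≤f₀))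
...   | no fᵢ≰f₀  = suc i , ℕ.+-mono-≤ (ℕ.<⇒≤ (ℕ.≰⇒> fᵢ≰f₀)) ∑tail≤

∃-large-support : ∀ {k m c} (F : Fin (suc k) → Vector ℤ m) →
                  (∀ e → suppSize (suc k) (λ i → F i e) ≡ c) →
                  ∃[ i ] c * m ≤ suc k * suppSize m (F i)
∃-large-support {k} {m} {c} F cover with ∃-≥-average (λ i → suppSize m (F i))
... | i , average = i , subst (_≤ suc k * suppSize m (F i)) total average
  where
  open ≡-Reasoning
  total : sum (λ i → suppSize m (F i)) ≡ c * m
  total = begin
    sum (λ i → suppSize m (F i))                 ≡⟨ suppSize-comm F ⟩
    sum (λ e → suppSize (suc k) (λ i → F i e))   ≡⟨ sum-cong-≗ {m} cover ⟩
    sum {m} (λ _ → c)                            ≡⟨ sum-const m c ⟩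
    m * c                                        ≡⟨ ℕ.*-comm m c ⟩
    c * m                                        ∎

corollary1p5 : (G : Graph) → HasNZFlow 4 G →
    Σ (Orientation G) λ o → Σ (Fin (E G) → ℤ) λ ψ →
    IsKFlow 3 G o ψ × (5 * E G ≤ 6 * suppSize (E G) ψ)
corollary1p5 G (o , φ , (φ-conservative , φ-bound) , φ≢0) =
  let (i , large) = ∃-large-support flow five-nonzero
  in  o , flow i , (from (conservative⇔circulation G o (flow i)) (circulation i) , bound i) , large
  where
  open SixThreeFlows
    (sixThreeFlows (arcs G o) φ (to (conservative⇔circulation G o φ) φ-conservative) φ≢0 φ-bound)
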